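{- Let $k$ be a non-zero integer and $g\in\{ -163,-3,6,326\}$. If $p$ is a prime not dividing $kg$ and $p=326n^2+3$ for some integer $n$, then $r_p(k^2g)$ is coprime to the product of all primes not exceeding $37$.
   Context: For a prime $p$ and an integer $h$ coprime to $p$, $r_p(h)=[(\mathbb Z/p\mathbb Z)^*:\langle h\rangle]$ is the residual index of $h\bmod p$. -}

module Defs where

open import Data.Nat as ℕ using (ℕ; suc; _∸_; _≤_; _<_)
open import Data.Nat.Primality using (Prime; prime?)
open import Data.Integer as ℤ using (ℤ; +_)
open import Data.Integer.Divisibility as ℤDiv using ()
open import Data.List using (List; filter; upTo)
open import Data.Nat.ListAction using (product)
open import Data.Product using (Σ; _×_)
open import Relation.Binary.PropositionalEquality using (_≡_)

CongMod : ℕ → ℤ → ℤ → Set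
CongMod m a b = (+ m) ℤDiv.∣ (a ℤ.- b)

IsOrder : ℕ → ℤ → ℕ → Set
IsOrder p h m =
  (0 < m) × (CongMod p (h ℤ.^ m) (+ 1)) ×
  (∀ j → 0 < j → j < m → (CongMod p (h ℤ.^ j) (+ 1) → Data.Empty.⊥))
  where import Data.Empty

-- r is the residual index r_p(h) = [(ℤ/pℤ)* : ⟨h⟩] = (p - 1) / |⟨h⟩|
IsResidualIndex : ℕ → ℤ → ℕ → Set
IsResidualIndex p h r = Σ ℕ λ m → IsOrder p h m × (r ℕ.* m ≡ p ∸ 1)

primorial : ℕ → ℕ
primorial n = product (filter prime? (upTo (suc n)))

-- Write p = 326n² + 3 = 1 + 2e, so e = 163n² + 1, and h = k²g. The residual index r divides
-- p − 1 = 2 + 326n², and 2 + 326x² has no root modulo any odd prime q ≤ 37, so no such q divides r.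
-- It remains to show that r is odd, which follows once h is a quadratic non-residue, h^e ≡ −1 (mod p).
-- By Fermat (k²)^e ≡ 1. For g, use p ≡ 2 (mod 3) and p ≡ 1, 3 (mod 8): then (−3)^e ≡ −1 and
-- (−2)^e ≡ 1, obtained by expanding (1 + √D)^p in ℤ[√D] once with the Frobenius congruence
-- (x + y)^p ≡ x^p + y^p and once explicitly. Since 326n² ≡ −3, 6 = (−2)(−3) and −163·(−2) = 326,
-- every admissible g satisfies g^e ≡ −1.

module Submission where

open import Defs using (IsResidualIndex; primorial)

open import Algebra.Bundles using (CommutativeSemiring)
open import Algebra.Structures using (IsCommutativeMonoid)
open import Algebra.Structures.Biased using (IsCommutativeSemiringˡ)
open import Data.Empty using (⊥-elim)
open import Data.Fin using (Fin; zero; suc; toℕ; fromℕ; fromℕ<; inject₁)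
open import Data.Fin.Properties using (toℕ<n; toℕ-fromℕ; toℕ-fromℕ<; toℕ-inject₁)
import Data.Fin.Properties as Fin
open import Data.List using (List; []; _∷_)
open import Data.List.Relation.Unary.All as All using (All; []; _∷_)
open import Data.Nat as ℕ using (ℕ; zero; suc; _<_; s≤s; z≤n; _%_; _/_)
import Data.Nat.Properties as ℕ
open import Data.Nat.Divisibility as ℕ using (divides)
import Data.Nat.Tactic.RingSolver as ℕ
open import Data.Nat.DivMod using (m%n<n; m≡m%n+[m/n]*n)
open import Data.Nat.Combinatorics using (_C_; nC1≡n; nCn≡1; nCk+nC[k+1]≡[n+1]C[k+1])
open import Data.Nat.Primality
  using (Prime; prime?; prime[2]; ¬prime[0]; ¬prime[1]; prime⇒nonZero; prime⇒irreducible; euclidsLemma)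
open import Data.Nat.Coprimality using (Coprime; coprime-divisor)
open import Data.Nat.ListAction using (product)
open import Data.Product using (∃; ∃-syntax; _,_; proj₁; proj₂)
open import Data.Sum using (_⊎_; inj₁; inj₂)
open import Function using (_∘_)
open import Level using (0ℓ)
open import Relation.Nullary using (¬_)
open import Relation.Nullary.Decidable using (Dec; from-yes; ¬?; _×-dec_)
open import Relation.Binary.Bundles using (Setoid)
open import Relation.Binary.Structures using (IsEquivalence)
open import Relation.Binary.PropositionalEquality as ≡ using (_≡_; _≢_; refl; cong; cong₂)

-- Binomial coefficients and the Frobenius congruence

[1+k]*[1+n]C[1+k]≡[1+n]*nCk : ∀ n k → suc k ℕ.* (suc n C suc k) ≡ suc n ℕ.* (n C k)
[1+k]*[1+n]C[1+k]≡[1+n]*nCk zero    zero    = refl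
[1+k]*[1+n]C[1+k]≡[1+n]*nCk zero    (suc k) = ℕ.*-zeroʳ (2 ℕ.+ k)
[1+k]*[1+n]C[1+k]≡[1+n]*nCk (suc n) zero    = begin
  1 ℕ.* (suc (suc n) C 1)  ≡⟨ ℕ.*-identityˡ _ ⟩
  suc (suc n) C 1          ≡⟨ nC1≡n (2 ℕ.+ n) ⟩
  2 ℕ.+ n                  ≡⟨ ℕ.*-identityʳ (2 ℕ.+ n) ⟨
  (2 ℕ.+ n) ℕ.* 1          ∎
  where open ≡.≡-Reasoning
[1+k]*[1+n]C[1+k]≡[1+n]*nCk (suc n) (suc k) = begin
  suc K ℕ.* (suc N C suc K)         ≡⟨ cong (suc K ℕ.*_) (nCk+nC[k+1]≡[n+1]C[k+1] N K) ⟨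
  suc K ℕ.* (N C K ℕ.+ N C suc K)   ≡⟨ regroup K (N C K) (N C suc K) ⟩
  N C K ℕ.+ (K ℕ.* (N C K) ℕ.+ suc K ℕ.* (N C suc K))
    ≡⟨ cong₂ (λ u v → N C K ℕ.+ (u ℕ.+ v)) ([1+k]*[1+n]C[1+k]≡[1+n]*nCk n k)
                                            ([1+k]*[1+n]C[1+k]≡[1+n]*nCk n (suc k)) ⟩
  N C K ℕ.+ (N ℕ.* (n C k) ℕ.+ N ℕ.* (n C suc k))
    ≡⟨ cong (N C K ℕ.+_) (ℕ.*-distribˡ-+ N (n C k) (n C suc k)) ⟨
  N C K ℕ.+ N ℕ.* (n C k ℕ.+ n C suc k)
    ≡⟨ cong (λ u → N C K ℕ.+ N ℕ.* u) (nCk+nC[k+1]≡[n+1]C[k+1] n k) ⟩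
  suc N ℕ.* (N C K) ∎
  where
  open ≡.≡-Reasoning
  N = suc n
  K = suc k
  regroup : ∀ K a b → suc K ℕ.* (a ℕ.+ b) ≡ a ℕ.+ (K ℕ.* a ℕ.+ suc K ℕ.* b)
  regroup = ℕ.solve-∀

prime∣pCk : ∀ {p k} → Prime p → 0 < k → k < p → p ℕ.∣ p C k
prime∣pCk {zero}  p-prime = ⊥-elim (¬prime[0] p-prime)
prime∣pCk {suc n} {suc k} p-prime _ k<p
  with euclidsLemma (suc k) (suc n C suc k) p-prime
         (divides (n C k) (≡.trans ([1+k]*[1+n]C[1+k]≡[1+n]*nCk n k) (ℕ.*-comm (suc n) (n C k))))
... | inj₂ p∣pCk = p∣pCk
... | inj₁ p∣k   = ⊥-elim (ℕ.<⇒≱ k<p (ℕ.∣⇒≤ p∣k))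

module Frobenius {c ℓ} (S : CommutativeSemiring c ℓ) where
  open CommutativeSemiring S hiding (zero)
  open import Algebra.Properties.Semiring.Exp semiring using (_^_)
  open import Algebra.Properties.CommutativeMonoid.Mult +-commutativeMonoid
    using (_×_; ×-assocˡ; ×-congˡ; ×-distrib-+)
  open import Algebra.Properties.Monoid.Sum +-monoid
    using (sum; sum-init-last; sum-cong-≋; sum-replicate; sum-replicate-zero)
  open import Algebra.Properties.CommutativeSemiring.Binomial S using (theorem; binomial; binomialTerm)
  open import Relation.Binary.Reasoning.Setoid setoid

  ×-zeroʳ : ∀ n → n × 0# ≈ 0#
  ×-zeroʳ n = trans (sym (sum-replicate n)) (sum-replicate-zero n)

  ×-distrib-sum : ∀ n {m} (f : Fin m → Carrier) → n × sum f ≈ sum (λ i → n × f i)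
  ×-distrib-sum n {zero}  f = ×-zeroʳ n
  ×-distrib-sum n {suc m} f = trans (×-distrib-+ (f zero) (sum (λ i → f (suc i))) n)
                                    (+-congˡ (×-distrib-sum n (λ i → f (suc i))))

  ×-factor : ∀ {p m} (p∣m : p ℕ.∣ m) x → m × x ≈ p × (ℕ._∣_.quotient p∣m × x)
  ×-factor {p} (divides q refl) x = trans (×-congˡ (ℕ.*-comm q p)) (sym (×-assocˡ x p q))

  frobenius : ∀ {p} → Prime p → ∀ x y → ∃[ w ] (x + y) ^ p ≈ x ^ p + y ^ p + p × w
  frobenius {zero}        p-prime = ⊥-elim (¬prime[0] p-prime)
  frobenius {suc zero}    p-prime = ⊥-elim (¬prime[1] p-prime)
  frobenius {suc (suc n)} p-prime x y = sum v , (begin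
    (x + y) ^ p                        ≈⟨ theorem p x y ⟩
    t zero + sum (λ i → t (suc i))     ≈⟨ +-congˡ (sum-init-last (λ i → t (suc i))) ⟩
    t zero + (sum middle + t (fromℕ p))
                                       ≈⟨ +-cong first (+-cong middle≈ last) ⟩
    y ^ p + (p × sum v + x ^ p)        ≈⟨ +-congˡ (+-comm _ _) ⟩
    y ^ p + (x ^ p + p × sum v)        ≈⟨ +-assoc _ _ _ ⟨
    y ^ p + x ^ p + p × sum v          ≈⟨ +-congʳ (+-comm _ _) ⟩
    x ^ p + y ^ p + p × sum v          ∎)
    where
    p = suc (suc n)
    t = binomialTerm x y p
    middle : Fin (suc n) → Carrier
    middle i = t (suc (inject₁ i))
    p∣middle : ∀ i → p ℕ.∣ p C suc (toℕ (inject₁ i))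
    p∣middle i = prime∣pCk p-prime (s≤s z≤n) (s≤s (≡.subst (_< suc n) (≡.sym (toℕ-inject₁ i)) (toℕ<n i)))
    v : Fin (suc n) → Carrier
    v i = ℕ._∣_.quotient (p∣middle i) × binomial x y p (suc (inject₁ i))
    first : t zero ≈ y ^ p
    first = trans (+-identityʳ _) (*-identityˡ _)
    last : t (fromℕ p) ≈ x ^ p
    last = term[p] (toℕ (fromℕ p)) (toℕ-fromℕ p)
      where
      term[p] : ∀ k → k ≡ p → (p C k) × (x ^ k * y ^ (p ℕ.∸ k)) ≈ x ^ p
      term[p] .p refl rewrite nCn≡1 p | ℕ.n∸n≡0 p = trans (+-identityʳ _) (*-identityʳ _)
    middle≈ : sum middle ≈ p × sum v
    middle≈ = trans (sum-cong-≋ (λ i → ×-factor (p∣middle i) (binomial x y p (suc (inject₁ i)))))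
                    (sym (×-distrib-sum p v))

-- Congruences of integers

-- Imported only here: inside Frobenius these operators would clash with the semiring's.
open import Data.Integer as ℤ using (ℤ; +_; -[1+_]; _+_; _*_; -_; _-_; ∣_∣; _^_)
import Data.Integer.Properties as ℤ
import Data.Integer.Divisibility as ℤDiv
open import Data.Integer.Divisibility.Signed
  using (_∣_; ∣ᵤ⇒∣; ∣⇒∣ᵤ; ∣m∣n⇒∣m+n; ∣m⇒∣-m; ∣n⇒∣m*n; ∣m⇒∣m*n; ∣-refl; ∣-trans; ∣m∣∣m)
open import Data.Integer.Tactic.RingSolver using (solve-∀)
open import Data.Product using (_×_)

infix 4 _≡_mod_

-- A record rather than a synonym for + n ∣ a - b, so that a and b stay inferable.
record _≡_mod_ (a b : ℤ) (n : ℕ) : Set where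
  constructor congruent
  field n∣a-b : + n ∣ a - b

open _≡_mod_

module _ {n : ℕ} where

  ≡⇒≡-mod : ∀ {a b} → a ≡ b → a ≡ b mod n
  ≡⇒≡-mod {a} refl = congruent (≡.subst (+ n ∣_) (≡.sym (ℤ.+-inverseʳ a)) (∣ᵤ⇒∣ (n ℕ.∣0)))

  ≡-mod-sym : ∀ {a b} → a ≡ b mod n → b ≡ a mod n
  ≡-mod-sym {a} {b} (congruent n∣a-b) = congruent (≡.subst (+ n ∣_) (flip a b) (∣m⇒∣-m n∣a-b))
    where
    flip : ∀ a b → - (a - b) ≡ b - a
    flip = solve-∀

  ≡-mod-trans : ∀ {a b c} → a ≡ b mod n → b ≡ c mod n → a ≡ c mod n
  ≡-mod-trans {a} {b} {c} (congruent n∣a-b) (congruent n∣b-c) =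
    congruent (≡.subst (+ n ∣_) (telescope a b c) (∣m∣n⇒∣m+n n∣a-b n∣b-c))
    where
    telescope : ∀ a b c → (a - b) + (b - c) ≡ a - c
    telescope = solve-∀

  ≡-mod-isEquivalence : IsEquivalence (λ a b → a ≡ b mod n)
  ≡-mod-isEquivalence = record
    { refl  = ≡⇒≡-mod refl
    ; sym   = ≡-mod-sym
    ; trans = ≡-mod-trans
    }

≡-mod-setoid : ℕ → Setoid _ _
≡-mod-setoid n = record { isEquivalence = ≡-mod-isEquivalence {n} }

module _ {n : ℕ} where

  +-cong-mod : ∀ {a b c d} → a ≡ b mod n → c ≡ d mod n → a + c ≡ b + d mod n
  +-cong-mod {a} {b} {c} {d} (congruent n∣a-b) (congruent n∣c-d) =
    congruent (≡.subst (+ n ∣_) (regroup a b c d) (∣m∣n⇒∣m+n n∣a-b n∣c-d))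
    where
    regroup : ∀ a b c d → (a - b) + (c - d) ≡ (a + c) - (b + d)
    regroup = solve-∀

  *-cong-mod : ∀ {a b c d} → a ≡ b mod n → c ≡ d mod n → a * c ≡ b * d mod n
  *-cong-mod {a} {b} {c} {d} (congruent n∣a-b) (congruent n∣c-d) =
    congruent (≡.subst (+ n ∣_) (regroup a b c d) (∣m∣n⇒∣m+n (∣m⇒∣m*n c n∣a-b) (∣n⇒∣m*n b n∣c-d)))
    where
    regroup : ∀ a b c d → (a - b) * c + b * (c - d) ≡ a * c - b * d
    regroup = solve-∀

  *-congˡ-mod : ∀ a {c d} → c ≡ d mod n → a * c ≡ a * d mod n
  *-congˡ-mod a = *-cong-mod (≡⇒≡-mod {a = a} refl)

  -‿cong-mod : ∀ {a b} → a ≡ b mod n → - a ≡ - b mod n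
  -‿cong-mod {a} {b} (congruent n∣a-b) = congruent (≡.subst (+ n ∣_) (regroup a b) (∣m⇒∣-m n∣a-b))
    where
    regroup : ∀ a b → - (a - b) ≡ - a - - b
    regroup = solve-∀

  ^-cong-mod : ∀ {a b} k → a ≡ b mod n → a ^ k ≡ b ^ k mod n
  ^-cong-mod zero    _   = ≡⇒≡-mod refl
  ^-cong-mod (suc k) a≡b = *-cong-mod a≡b (^-cong-mod k a≡b)

  +-multiple-mod : ∀ a w → a + + n * w ≡ a mod n
  +-multiple-mod a w = congruent (≡.subst (+ n ∣_) (regroup a (+ n) w) (∣m⇒∣m*n w ∣-refl))
    where
    regroup : ∀ a n w → n * w ≡ (a + n * w) - a
    regroup = solve-∀

*-cancelˡ-mod : ∀ {p c a b} → Prime p → ¬ (+ p ∣ c) → c * a ≡ c * b mod p → a ≡ b mod p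
*-cancelˡ-mod {p} {c} {a} {b} p-prime p∤c (congruent p∣ca-cb)
  with euclidsLemma ∣ c ∣ ∣ a - b ∣ p-prime (≡.subst (p ℕ.∣_) (ℤ.abs-* c (a - b)) (∣⇒∣ᵤ p∣c[a-b]))
  where
  factor : ∀ c a b → c * a - c * b ≡ c * (a - b)
  factor = solve-∀
  p∣c[a-b] : + p ∣ c * (a - b)
  p∣c[a-b] = ≡.subst (+ p ∣_) (factor c a b) p∣ca-cb
... | inj₁ p∣c   = ⊥-elim (p∤c (∣ᵤ⇒∣ p∣c))
... | inj₂ p∣a-b = congruent (∣ᵤ⇒∣ p∣a-b)

-- Fermat's little theorem

module _ where
  open Frobenius ℤ.+-*-commutativeSemiring using (frobenius)
  open import Algebra.Definitions.RawMonoid ℤ.+-0-rawMonoid using () renaming (_×_ to _×ℤ_)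
  open import Algebra.Definitions.RawSemiring ℤ.+-*-rawSemiring using () renaming (_^_ to _^ℤ_)

  -- The semiring power is a different recursion from ℤ._^_, equal to it only propositionally.
  ^ℤ≡^ : ∀ a n → a ^ℤ n ≡ a ^ n
  ^ℤ≡^ a zero    = refl
  ^ℤ≡^ a (suc n) = cong (a *_) (^ℤ≡^ a n)

  ×ℤ≡* : ∀ n w → n ×ℤ w ≡ + n * w
  ×ℤ≡* zero    w = refl
  ×ℤ≡* (suc n) w = ≡.trans (cong (λ u → w + u) (×ℤ≡* n w)) (≡.sym (ℤ.suc-* (+ n) w))

  frobenius-mod : ∀ {p} → Prime p → ∀ a b → (a + b) ^ p ≡ a ^ p + b ^ p mod p
  frobenius-mod {p} p-prime a b with frobenius p-prime a b
  ... | w , eq = ≡-mod-trans (≡⇒≡-mod (begin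
    (a + b) ^ p                ≡⟨ ^ℤ≡^ (a + b) p ⟨
    (a + b) ^ℤ p               ≡⟨ eq ⟩
    a ^ℤ p + b ^ℤ p + p ×ℤ w   ≡⟨ cong₂ _+_ (cong₂ _+_ (^ℤ≡^ a p) (^ℤ≡^ b p)) (×ℤ≡* p w) ⟩
    a ^ p + b ^ p + + p * w    ∎))
    (+-multiple-mod (a ^ p + b ^ p) w)
    where open ≡.≡-Reasoning

a^p≡a-mod : ∀ {p} → Prime p → ∀ a → (+ a) ^ p ≡ + a mod p
a^p≡a-mod {zero}  p-prime = ⊥-elim (¬prime[0] p-prime)
a^p≡a-mod {suc _} p-prime zero    = ≡⇒≡-mod refl
a^p≡a-mod {p}     p-prime (suc a) = begin
  (+ 1 + + a) ^ p       ≈⟨ frobenius-mod p-prime (+ 1) (+ a) ⟩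
  (+ 1) ^ p + (+ a) ^ p ≈⟨ +-cong-mod (≡⇒≡-mod (ℤ.^-zeroˡ p)) (a^p≡a-mod p-prime a) ⟩
  + 1 + + a             ∎
  where open import Relation.Binary.Reasoning.Setoid (≡-mod-setoid p)

fermat : ∀ {p a} → Prime p → ¬ (+ p ∣ + a) → (+ a) ^ (p ℕ.∸ 1) ≡ + 1 mod p
fermat {zero}  p-prime = ⊥-elim (¬prime[0] p-prime)
fermat {suc p-1} {a} p-prime p∤a = *-cancelˡ-mod p-prime p∤a (begin
  + a * (+ a) ^ p-1   ≈⟨ a^p≡a-mod p-prime a ⟩
  + a                 ≡⟨ ℤ.*-identityʳ (+ a) ⟨
  + a * + 1           ∎)
  where open import Relation.Binary.Reasoning.Setoid (≡-mod-setoid (suc p-1))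

square≡∣∣² : ∀ k → k * k ≡ + ∣ k ∣ * + ∣ k ∣
square≡∣∣² (+ _)    = refl
square≡∣∣² -[1+ _ ] = refl

square^e≡1 : ∀ {p} e k → Prime p → p ≡ suc (2 ℕ.* e) → ¬ (+ p ∣ k) → (k * k) ^ e ≡ + 1 mod p
square^e≡1 {p} e k p-prime refl p∤k = begin
  (k * k) ^ e                ≡⟨ cong (_^ e) (square≡∣∣² k) ⟩
  (+ ∣ k ∣ * + ∣ k ∣) ^ e    ≡⟨ cong (λ u → (+ ∣ k ∣ * u) ^ e) (ℤ.*-identityʳ (+ ∣ k ∣)) ⟨
  ((+ ∣ k ∣) ^ 2) ^ e        ≡⟨ ℤ.^-*-assoc (+ ∣ k ∣) 2 e ⟩
  (+ ∣ k ∣) ^ (2 ℕ.* e)      ≈⟨ fermat p-prime (λ p∣∣k∣ → p∤k (∣-trans p∣∣k∣ ∣m∣∣m)) ⟩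
  + 1                        ∎
  where open import Relation.Binary.Reasoning.Setoid (≡-mod-setoid p)

-- The rings ℤ[√D] and the quadratic characters of −3 and −2

-- (a , b) stands for a + b√D.
module Quadratic (D : ℤ) where

  infixl 6 _⊕_
  infixl 7 _⊗_

  _⊕_ : ℤ × ℤ → ℤ × ℤ → ℤ × ℤ
  (a , b) ⊕ (c , d) = (a + c , b + d)

  _⊗_ : ℤ × ℤ → ℤ × ℤ → ℤ × ℤ
  (a , b) ⊗ (c , d) = (a * c + D * (b * d) , a * d + b * c)

  ⊕-isCommutativeMonoid : IsCommutativeMonoid _≡_ _⊕_ (+ 0 , + 0)
  ⊕-isCommutativeMonoid = record
    { isMonoid = record
      { isSemigroup = record
        { isMagma = record { isEquivalence = ≡.isEquivalence ; ∙-cong = cong₂ _⊕_ }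
        ; assoc   = λ (a , b) (c , d) (e , f) → cong₂ _,_ (ℤ.+-assoc a c e) (ℤ.+-assoc b d f)
        }
      ; identity = (λ (a , b) → cong₂ _,_ (ℤ.+-identityˡ a) (ℤ.+-identityˡ b))
                 , (λ (a , b) → cong₂ _,_ (ℤ.+-identityʳ a) (ℤ.+-identityʳ b))
      }
    ; comm = λ (a , b) (c , d) → cong₂ _,_ (ℤ.+-comm a c) (ℤ.+-comm b d)
    }

  ⊗-comm : ∀ x y → x ⊗ y ≡ y ⊗ x
  ⊗-comm (a , b) (c , d) = cong₂ _,_ (comm₁ D a b c d) (comm₂ a b c d)
    where
    comm₁ : ∀ D a b c d → a * c + D * (b * d) ≡ c * a + D * (d * b)
    comm₁ = solve-∀
    comm₂ : ∀ a b c d → a * d + b * c ≡ c * b + d * a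
    comm₂ = solve-∀

  ⊗-identityˡ : ∀ x → (+ 1 , + 0) ⊗ x ≡ x
  ⊗-identityˡ (a , b) = cong₂ _,_ (id₁ D a b) (id₂ a b)
    where
    id₁ : ∀ D a b → + 1 * a + D * (+ 0 * b) ≡ a
    id₁ = solve-∀
    id₂ : ∀ a b → + 1 * b + + 0 * a ≡ b
    id₂ = solve-∀

  ⊗-isCommutativeMonoid : IsCommutativeMonoid _≡_ _⊗_ (+ 1 , + 0)
  ⊗-isCommutativeMonoid = record
    { isMonoid = record
      { isSemigroup = record
        { isMagma = record { isEquivalence = ≡.isEquivalence ; ∙-cong = cong₂ _⊗_ }
        ; assoc   = λ (a , b) (c , d) (e , f) → cong₂ _,_ (assoc₁ D a b c d e f) (assoc₂ D a b c d e f)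
        }
      ; identity = ⊗-identityˡ , λ x → ≡.trans (⊗-comm x _) (⊗-identityˡ x)
      }
    ; comm = ⊗-comm
    }
    where
    assoc₁ : ∀ D a b c d e f → (a * c + D * (b * d)) * e + D * ((a * d + b * c) * f)
                             ≡ a * (c * e + D * (d * f)) + D * (b * (c * f + d * e))
    assoc₁ = solve-∀
    assoc₂ : ∀ D a b c d e f → (a * c + D * (b * d)) * f + (a * d + b * c) * e
                             ≡ a * (c * f + d * e) + b * (c * e + D * (d * f))
    assoc₂ = solve-∀

  commutativeSemiring : CommutativeSemiring 0ℓ 0ℓ
  commutativeSemiring = record
    { isCommutativeSemiring = IsCommutativeSemiringˡ.isCommutativeSemiring record
      { +-isCommutativeMonoid = ⊕-isCommutativeMonoid
      ; *-isCommutativeMonoid = ⊗-isCommutativeMonoid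
      ; distribʳ = λ (a , b) (c , d) (e , f) → cong₂ _,_ (distrib₁ D a b c d e f) (distrib₂ a b c d e f)
      ; zeroˡ    = λ (a , b) → cong₂ _,_ (zero₁ D a b) (zero₂ a b)
      }
    }
    where
    distrib₁ : ∀ D a b c d e f → (c + e) * a + D * ((d + f) * b) ≡ (c * a + D * (d * b)) + (e * a + D * (f * b))
    distrib₁ = solve-∀
    distrib₂ : ∀ a b c d e f → (c + e) * b + (d + f) * a ≡ (c * b + d * a) + (e * b + f * a)
    distrib₂ = solve-∀
    zero₁ : ∀ D a b → + 0 * a + D * (+ 0 * b) ≡ + 0
    zero₁ = solve-∀
    zero₂ : ∀ a b → + 0 * b + + 0 * a ≡ + 0
    zero₂ = solve-∀

  open Frobenius commutativeSemiring using (frobenius)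
  open CommutativeSemiring commutativeSemiring using (semiring; +-rawMonoid)
  open import Algebra.Properties.Semiring.Exp semiring using (^-assocʳ; ^-homo-*) renaming (_^_ to _↑_) public
  open import Algebra.Definitions.RawMonoid +-rawMonoid using () renaming (_×_ to _·_)

  ↑-split : ∀ x m k j → x ↑ (m ℕ.+ k ℕ.* j) ≡ x ↑ m ⊗ (x ↑ k) ↑ j
  ↑-split x m k j = ≡.trans (^-homo-* x m (k ℕ.* j)) (cong (x ↑ m ⊗_) (≡.sym (^-assocʳ x k j)))

  infix 4 _≋_mod_

  _≋_mod_ : ℤ × ℤ → ℤ × ℤ → ℕ → Set
  x ≋ y mod n = proj₁ x ≡ proj₁ y mod n × proj₂ x ≡ proj₂ y mod n

  ·≡* : ∀ n a b → n · (a , b) ≡ (+ n * a , + n * b)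
  ·≡* zero    a b = refl
  ·≡* (suc n) a b rewrite ·≡* n a b = cong₂ _,_ (≡.sym (ℤ.suc-* (+ n) a)) (≡.sym (ℤ.suc-* (+ n) b))

  frobenius-≋ : ∀ {p} → Prime p → ∀ x y → (x ⊕ y) ↑ p ≋ x ↑ p ⊕ y ↑ p mod p
  frobenius-≋ {p} p-prime x y with frobenius p-prime x y
  ... | (w₁ , w₂) , eq rewrite eq | ·≡* p w₁ w₂ = +-multiple-mod _ w₁ , +-multiple-mod _ w₂

  embed-↑ : ∀ c j → (c , + 0) ↑ j ≡ (c ^ j , + 0)
  embed-↑ c zero    = refl
  embed-↑ c (suc j) rewrite embed-↑ c j = cong₂ _,_ (fst D c (c ^ j)) (snd c (c ^ j))
    where
    fst : ∀ D c X → c * X + D * (+ 0 * + 0) ≡ c * X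
    fst = solve-∀
    snd : ∀ c X → c * + 0 + + 0 * X ≡ + 0
    snd = solve-∀

  √D↑odd : ∀ e → (+ 0 , + 1) ↑ suc (2 ℕ.* e) ≡ (+ 0 , D ^ e)
  √D↑odd e = begin
    √D ⊗ √D ↑ (2 ℕ.* e)    ≡⟨ cong (√D ⊗_) (^-assocʳ √D 2 e) ⟨
    √D ⊗ (√D ↑ 2) ↑ e      ≡⟨ cong (λ u → √D ⊗ u ↑ e) √D² ⟩
    √D ⊗ (D , + 0) ↑ e     ≡⟨ cong (√D ⊗_) (embed-↑ D e) ⟩
    √D ⊗ (D ^ e , + 0)     ≡⟨ cong₂ _,_ (fst D (D ^ e)) (snd (D ^ e)) ⟩
    (+ 0 , D ^ e)          ∎
    where
    open ≡.≡-Reasoning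
    √D = (+ 0 , + 1)
    √D² : √D ↑ 2 ≡ (D , + 0)
    √D² = cong₂ _,_ (sq₁ D) (sq₂ D)
      where
      sq₁ : ∀ D → + 0 * (+ 0 * + 1 + D * (+ 1 * + 0)) + D * (+ 1 * (+ 0 * + 0 + + 1 * + 1)) ≡ D
      sq₁ = solve-∀
      sq₂ : ∀ D → + 0 * (+ 0 * + 0 + + 1 * + 1) + + 1 * (+ 0 * + 1 + D * (+ 1 * + 0)) ≡ + 0
      sq₂ = solve-∀
    fst : ∀ D X → + 0 * X + D * (+ 1 * + 0) ≡ + 0
    fst = solve-∀
    snd : ∀ X → + 0 * + 0 + + 1 * X ≡ X
    snd = solve-∀

  [1+√D]↑p≋1+D^e√D : ∀ {p} e → Prime p → p ≡ suc (2 ℕ.* e) → (+ 1 , + 1) ↑ p ≋ (+ 1 , D ^ e) mod p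
  [1+√D]↑p≋1+D^e√D {p} e p-prime p≡1+2e =
    ≡-mod-trans fst≡ (≡⇒≡-mod (cong proj₁ 1↑p+√D↑p≡1+D^e√D)) ,
    ≡-mod-trans snd≡ (≡⇒≡-mod (cong proj₂ 1↑p+√D↑p≡1+D^e√D))
    where
    open ≡.≡-Reasoning
    frobenius-1+√D = frobenius-≋ p-prime (+ 1 , + 0) (+ 0 , + 1)
    fst≡ = proj₁ frobenius-1+√D
    snd≡ = proj₂ frobenius-1+√D
    √D↑p≡D^e√D : (+ 0 , + 1) ↑ p ≡ (+ 0 , D ^ e)
    √D↑p≡D^e√D = ≡.subst (λ q → (+ 0 , + 1) ↑ q ≡ (+ 0 , D ^ e)) (≡.sym p≡1+2e) (√D↑odd e)
    1↑p+√D↑p≡1+D^e√D : (+ 1 , + 0) ↑ p ⊕ (+ 0 , + 1) ↑ p ≡ (+ 1 , D ^ e)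
    1↑p+√D↑p≡1+D^e√D = begin
      (+ 1 , + 0) ↑ p ⊕ (+ 0 , + 1) ↑ p  ≡⟨ cong₂ _⊕_ (embed-↑ (+ 1) p) √D↑p≡D^e√D ⟩
      ((+ 1) ^ p , + 0) ⊕ (+ 0 , D ^ e)  ≡⟨ cong₂ _,_ (≡.trans (ℤ.+-identityʳ _) (ℤ.^-zeroˡ p))
                                                      (ℤ.+-identityˡ (D ^ e)) ⟩
      (+ 1 , D ^ e)                      ∎

[1+√-3]↑[2+3j] : ∀ j → let open Quadratic (- + 3); A = (- + 8) ^ j in
                 (+ 1 , + 1) ↑ (2 ℕ.+ 3 ℕ.* j) ≡ (- (+ 2 * A) , + 2 * A)
[1+√-3]↑[2+3j] j = begin
  (+ 1 , + 1) ↑ (2 ℕ.+ 3 ℕ.* j)     ≡⟨ ↑-split (+ 1 , + 1) 2 3 j ⟩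
  (- + 2 , + 2) ⊗ (- + 8 , + 0) ↑ j ≡⟨ cong ((- + 2 , + 2) ⊗_) (embed-↑ (- + 8) j) ⟩
  (- + 2 , + 2) ⊗ (A , + 0)         ≡⟨ cong₂ _,_ (fst A) (snd A) ⟩
  (- (+ 2 * A) , + 2 * A)           ∎
  where
  open ≡.≡-Reasoning
  open Quadratic (- + 3)
  A = (- + 8) ^ j
  fst : ∀ A → - + 2 * A + - + 3 * (+ 2 * + 0) ≡ - (+ 2 * A)
  fst = solve-∀
  snd : ∀ A → - + 2 * + 0 + + 2 * A ≡ + 2 * A
  snd = solve-∀

-3^e≡-1 : ∀ {p} e → Prime p → p ≡ suc (2 ℕ.* e) → ∃[ j ] p ≡ 2 ℕ.+ 3 ℕ.* j → (- + 3) ^ e ≡ - + 1 mod p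
-3^e≡-1 {p} e p-prime p≡1+2e (j , refl) = begin
  (- + 3) ^ e        ≈⟨ proj₂ [1+√-3]↑p≋1+[-3]^e√-3 ⟨
  + 2 * A            ≡⟨ ℤ.neg-involutive (+ 2 * A) ⟨
  - (- (+ 2 * A))    ≈⟨ -‿cong-mod (proj₁ [1+√-3]↑p≋1+[-3]^e√-3) ⟩
  - + 1              ∎
  where
  open Quadratic (- + 3)
  open import Relation.Binary.Reasoning.Setoid (≡-mod-setoid p)
  A = (- + 8) ^ j
  [1+√-3]↑p≋1+[-3]^e√-3 : (- (+ 2 * A) , + 2 * A) ≋ (+ 1 , (- + 3) ^ e) mod p
  [1+√-3]↑p≋1+[-3]^e√-3 =
    ≡.subst (_≋ (+ 1 , (- + 3) ^ e) mod p) ([1+√-3]↑[2+3j] j) ([1+√D]↑p≋1+D^e√D e p-prime p≡1+2e)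

proj₁[1+i]↑[1+8j] : ∀ j → let open Quadratic (- + 1) in
                    proj₁ ((+ 1 , + 1) ↑ (1 ℕ.+ 8 ℕ.* j)) ≡ (- + 2) ^ (4 ℕ.* j)
proj₁[1+i]↑[1+8j] j = begin
  proj₁ ((+ 1 , + 1) ↑ (1 ℕ.+ 8 ℕ.* j))      ≡⟨ cong proj₁ (↑-split (+ 1 , + 1) 1 8 j) ⟩
  proj₁ ((+ 1 , + 1) ⊗ (+ 16 , + 0) ↑ j)     ≡⟨ cong (λ u → proj₁ ((+ 1 , + 1) ⊗ u)) (embed-↑ (+ 16) j) ⟩
  + 1 * (+ 16) ^ j + - + 1 * (+ 1 * + 0)       ≡⟨ fst ((+ 16) ^ j) ⟩
  (+ 16) ^ j                                   ≡⟨ ℤ.^-*-assoc (- + 2) 4 j ⟩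
  (- + 2) ^ (4 ℕ.* j)                        ∎
  where
  open ≡.≡-Reasoning
  open Quadratic (- + 1)
  fst : ∀ A → + 1 * A + - + 1 * (+ 1 * + 0) ≡ A
  fst = solve-∀

proj₁[1+i]↑[3+8j] : ∀ j → let open Quadratic (- + 1) in
                    proj₁ ((+ 1 , + 1) ↑ (3 ℕ.+ 8 ℕ.* j)) ≡ (- + 2) ^ (1 ℕ.+ 4 ℕ.* j)
proj₁[1+i]↑[3+8j] j = begin
  proj₁ ((+ 1 , + 1) ↑ (3 ℕ.+ 8 ℕ.* j))      ≡⟨ cong proj₁ (↑-split (+ 1 , + 1) 3 8 j) ⟩
  proj₁ ((- + 2 , + 2) ⊗ (+ 16 , + 0) ↑ j)   ≡⟨ cong (λ u → proj₁ ((- + 2 , + 2) ⊗ u)) (embed-↑ (+ 16) j) ⟩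
  - + 2 * (+ 16) ^ j + - + 1 * (+ 2 * + 0)     ≡⟨ fst ((+ 16) ^ j) ⟩
  - + 2 * (+ 16) ^ j                           ≡⟨ cong (- + 2 *_) (ℤ.^-*-assoc (- + 2) 4 j) ⟩
  (- + 2) ^ (1 ℕ.+ 4 ℕ.* j)                  ∎
  where
  open ≡.≡-Reasoning
  open Quadratic (- + 1)
  fst : ∀ A → - + 2 * A + - + 1 * (+ 2 * + 0) ≡ - + 2 * A
  fst = solve-∀

-2^e≡1 : ∀ {p} e → Prime p → p ≡ suc (2 ℕ.* e) → ∃[ j ] (p ≡ 1 ℕ.+ 8 ℕ.* j ⊎ p ≡ 3 ℕ.+ 8 ℕ.* j) →
         (- + 2) ^ e ≡ + 1 mod p
-2^e≡1 {p} e p-prime p≡1+2e (j , inj₁ refl) = begin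
  (- + 2) ^ e                            ≡⟨ cong ((- + 2) ^_) e≡4j ⟩
  (- + 2) ^ (4 ℕ.* j)                    ≡⟨ proj₁[1+i]↑[1+8j] j ⟨
  proj₁ ((+ 1 , + 1) ↑ (1 ℕ.+ 8 ℕ.* j))  ≈⟨ proj₁ ([1+√D]↑p≋1+D^e√D e p-prime p≡1+2e) ⟩
  + 1                                    ∎
  where
  open Quadratic (- + 1)
  open import Relation.Binary.Reasoning.Setoid (≡-mod-setoid p)
  e≡4j : e ≡ 4 ℕ.* j
  e≡4j = ℕ.*-cancelˡ-≡ e (4 ℕ.* j) 2 (≡.trans (ℕ.suc-injective (≡.sym p≡1+2e)) (ℕ.*-assoc 2 4 j))
-2^e≡1 {p} e p-prime p≡1+2e (j , inj₂ refl) = begin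
  (- + 2) ^ e                            ≡⟨ cong ((- + 2) ^_) e≡1+4j ⟩
  (- + 2) ^ (1 ℕ.+ 4 ℕ.* j)              ≡⟨ proj₁[1+i]↑[3+8j] j ⟨
  proj₁ ((+ 1 , + 1) ↑ (3 ℕ.+ 8 ℕ.* j))  ≈⟨ proj₁ ([1+√D]↑p≋1+D^e√D e p-prime p≡1+2e) ⟩
  + 1                                    ∎
  where
  open Quadratic (- + 1)
  open import Relation.Binary.Reasoning.Setoid (≡-mod-setoid p)
  regroup : ∀ j → 2 ℕ.+ 8 ℕ.* j ≡ 2 ℕ.* (1 ℕ.+ 4 ℕ.* j)
  regroup = ℕ.solve-∀
  e≡1+4j : e ≡ 1 ℕ.+ 4 ℕ.* j
  e≡1+4j = ℕ.*-cancelˡ-≡ e (1 ℕ.+ 4 ℕ.* j) 2 (≡.trans (ℕ.suc-injective (≡.sym p≡1+2e)) (regroup j))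

-- Primes of the form 326n² + 3

^-distribʳ-* : ∀ a b n → (a * b) ^ n ≡ a ^ n * b ^ n
^-distribʳ-* a b zero    = refl
^-distribʳ-* a b (suc n) rewrite ^-distribʳ-* a b n = interchange a b (a ^ n) (b ^ n)
  where
  interchange : ∀ a b x y → a * b * (x * y) ≡ a * x * (b * y)
  interchange = solve-∀

326n²+3 : ℕ → ℕ
326n²+3 n = 3 ℕ.+ 326 ℕ.* (n ℕ.* n)

163n²+1 : ℕ → ℕ
163n²+1 n = 1 ℕ.+ 163 ℕ.* (n ℕ.* n)

+326n²+3 : ∀ n → + 326n²+3 n ≡ + 3 + + 326 * (+ n * + n)
+326n²+3 n = ≡.trans (ℤ.pos-+ 3 (326 ℕ.* (n ℕ.* n)))
                (cong (ℤ._+_ (+ 3)) (≡.trans (ℤ.pos-* 326 (n ℕ.* n)) (cong (+ 326 *_) (ℤ.pos-* n n))))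

326n²+3≡1+2[163n²+1] : ∀ n → 326n²+3 n ≡ suc (2 ℕ.* 163n²+1 n)
326n²+3≡1+2[163n²+1] n = regroup (n ℕ.* n)
  where
  regroup : ∀ x → 3 ℕ.+ 326 ℕ.* x ≡ suc (2 ℕ.* (1 ℕ.+ 163 ℕ.* x))
  regroup = ℕ.solve-∀

326n²+3≡2mod3 : ∀ n → Prime (326n²+3 (suc n)) → ∃[ j ] 326n²+3 (suc n) ≡ 2 ℕ.+ 3 ℕ.* j
326n²+3≡2mod3 n p-prime with suc n % 3 | m%n<n (suc n) 3 | m≡m%n+[m/n]*n (suc n) 3
... | 0 | _ | N≡3t = ⊥-elim (3≢p (prime⇒irreducible p-prime 3∣p))
  where
  t = suc n / 3
  regroup : ∀ t → 3 ℕ.+ 326 ℕ.* (t ℕ.* 3 ℕ.* (t ℕ.* 3)) ≡ (1 ℕ.+ 978 ℕ.* (t ℕ.* t)) ℕ.* 3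
  regroup = ℕ.solve-∀
  3∣p : 3 ℕ.∣ 326n²+3 (suc n)
  3∣p = divides (1 ℕ.+ 978 ℕ.* (t ℕ.* t)) (≡.trans (cong 326n²+3 N≡3t) (regroup t))
  3≢p : ¬ (3 ≡ 1 ⊎ 3 ≡ 326n²+3 (suc n))
  3≢p (inj₁ ())
  3≢p (inj₂ ())
... | 1 | _ | N≡1+3t = 109 ℕ.+ 652 ℕ.* t ℕ.+ 978 ℕ.* (t ℕ.* t) , ≡.trans (cong 326n²+3 N≡1+3t) (regroup t)
  where
  t = suc n / 3
  regroup : ∀ t → 3 ℕ.+ 326 ℕ.* ((1 ℕ.+ t ℕ.* 3) ℕ.* (1 ℕ.+ t ℕ.* 3))
                ≡ 2 ℕ.+ 3 ℕ.* (109 ℕ.+ 652 ℕ.* t ℕ.+ 978 ℕ.* (t ℕ.* t))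
  regroup = ℕ.solve-∀
... | 2 | _ | N≡2+3t = 435 ℕ.+ 1304 ℕ.* t ℕ.+ 978 ℕ.* (t ℕ.* t) , ≡.trans (cong 326n²+3 N≡2+3t) (regroup t)
  where
  t = suc n / 3
  regroup : ∀ t → 3 ℕ.+ 326 ℕ.* ((2 ℕ.+ t ℕ.* 3) ℕ.* (2 ℕ.+ t ℕ.* 3))
                ≡ 2 ℕ.+ 3 ℕ.* (435 ℕ.+ 1304 ℕ.* t ℕ.+ 978 ℕ.* (t ℕ.* t))
  regroup = ℕ.solve-∀
... | suc (suc (suc _)) | s≤s (s≤s (s≤s ())) | _

326n²+3≡1or3mod8 : ∀ n → ∃[ j ] (326n²+3 n ≡ 1 ℕ.+ 8 ℕ.* j ⊎ 326n²+3 n ≡ 3 ℕ.+ 8 ℕ.* j)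
326n²+3≡1or3mod8 n with n % 2 | m%n<n n 2 | m≡m%n+[m/n]*n n 2
... | 0 | _ | n≡2t = 163 ℕ.* (t ℕ.* t) , inj₂ (≡.trans (cong 326n²+3 n≡2t) (regroup t))
  where
  t = n / 2
  regroup : ∀ t → 3 ℕ.+ 326 ℕ.* (t ℕ.* 2 ℕ.* (t ℕ.* 2)) ≡ 3 ℕ.+ 8 ℕ.* (163 ℕ.* (t ℕ.* t))
  regroup = ℕ.solve-∀
... | 1 | _ | n≡1+2t = 41 ℕ.+ 163 ℕ.* t ℕ.+ 163 ℕ.* (t ℕ.* t) , inj₁ (≡.trans (cong 326n²+3 n≡1+2t) (regroup t))
  where
  t = n / 2
  regroup : ∀ t → 3 ℕ.+ 326 ℕ.* ((1 ℕ.+ t ℕ.* 2) ℕ.* (1 ℕ.+ t ℕ.* 2))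
                ≡ 1 ℕ.+ 8 ℕ.* (41 ℕ.+ 163 ℕ.* t ℕ.+ 163 ℕ.* (t ℕ.* t))
  regroup = ℕ.solve-∀
... | suc (suc _) | s≤s (s≤s ()) | _

326^e≡-1 : ∀ n → Prime (326n²+3 (suc n)) → (+ 326) ^ 163n²+1 (suc n) ≡ - + 1 mod 326n²+3 (suc n)
326^e≡-1 n p-prime = begin
  (+ 326) ^ e                       ≡⟨ ℤ.*-identityʳ ((+ 326) ^ e) ⟨
  (+ 326) ^ e * + 1                 ≈⟨ *-congˡ-mod ((+ 326) ^ e) (≡-mod-sym (square^e≡1 e (+ N) p-prime p≡1+2e p∤N)) ⟩
  (+ 326) ^ e * (+ N * + N) ^ e     ≡⟨ ^-distribʳ-* (+ 326) (+ N * + N) e ⟨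
  (+ 326 * (+ N * + N)) ^ e         ≈⟨ ^-cong-mod e 326N²≡-3 ⟩
  (- + 3) ^ e                       ≈⟨ -3^e≡-1 e p-prime p≡1+2e (326n²+3≡2mod3 n p-prime) ⟩
  - + 1                             ∎
  where
  N = suc n
  p = 326n²+3 N
  e = 163n²+1 N
  open import Relation.Binary.Reasoning.Setoid (≡-mod-setoid p)
  p≡1+2e = 326n²+3≡1+2[163n²+1] N
  p∤N : ¬ (+ p ∣ + N)
  p∤N p∣N = p≰3 (ℕ.∣⇒≤ (ℕ.∣m+n∣m⇒∣n (≡.subst (p ℕ.∣_) (ℕ.+-comm 3 _) ℕ.∣-refl) p∣326N²))
    where
    p∣326N² : p ℕ.∣ 326 ℕ.* (N ℕ.* N)
    p∣326N² = ℕ.∣n⇒∣m*n 326 (ℕ.∣m⇒∣m*n N (∣⇒∣ᵤ p∣N))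
    p≰3 : ¬ (p ℕ.≤ 3)
    p≰3 (s≤s (s≤s (s≤s ())))
  326N²≡-3 : + 326 * (+ N * + N) ≡ - + 3 mod p
  326N²≡-3 = congruent (≡.subst (+ p ∣_) p≡326N²--3 ∣-refl)
    where
    regroup : ∀ x → + 3 + x ≡ x - - + 3
    regroup = solve-∀
    p≡326N²--3 : + p ≡ + 326 * (+ N * + N) - - + 3
    p≡326N²--3 = ≡.trans (+326n²+3 N) (regroup (+ 326 * (+ N * + N)))

g^e≡-1 : ∀ n {g} → g ≡ - + 163 ⊎ g ≡ - + 3 ⊎ g ≡ + 6 ⊎ g ≡ + 326 →
         Prime (326n²+3 n) → ¬ (+ 326n²+3 n ∣ g) → g ^ 163n²+1 n ≡ - + 1 mod 326n²+3 n
-- For p = 3 the general argument breaks down (−3 ≡ 0), and the two admissible g are checked directly.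
g^e≡-1 zero    (inj₁ refl)                _ _   = congruent (∣ᵤ⇒∣ (divides 54 refl))
g^e≡-1 zero    (inj₂ (inj₁ refl))         _ 3∤g = ⊥-elim (3∤g (∣ᵤ⇒∣ (divides 1 refl)))
g^e≡-1 zero    (inj₂ (inj₂ (inj₁ refl)))  _ 3∤g = ⊥-elim (3∤g (∣ᵤ⇒∣ (divides 2 refl)))
g^e≡-1 zero    (inj₂ (inj₂ (inj₂ refl)))  _ _   = congruent (∣ᵤ⇒∣ (divides 109 refl))
g^e≡-1 (suc n) (inj₁ refl) p-prime _ = begin
  (- + 163) ^ e                      ≡⟨ ℤ.*-identityʳ ((- + 163) ^ e) ⟨
  (- + 163) ^ e * + 1                ≈⟨ *-congˡ-mod ((- + 163) ^ e) (-2^e≡1 e p-prime p≡1+2e (326n²+3≡1or3mod8 (suc n))) ⟨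
  (- + 163) ^ e * (- + 2) ^ e        ≡⟨ ^-distribʳ-* (- + 163) (- + 2) e ⟨
  (+ 326) ^ e                        ≈⟨ 326^e≡-1 n p-prime ⟩
  - + 1                              ∎
  where
  e = 163n²+1 (suc n)
  p≡1+2e = 326n²+3≡1+2[163n²+1] (suc n)
  open import Relation.Binary.Reasoning.Setoid (≡-mod-setoid (326n²+3 (suc n)))
g^e≡-1 (suc n) (inj₂ (inj₁ refl)) p-prime _ =
  -3^e≡-1 (163n²+1 (suc n)) p-prime (326n²+3≡1+2[163n²+1] (suc n)) (326n²+3≡2mod3 n p-prime)
g^e≡-1 (suc n) (inj₂ (inj₂ (inj₁ refl))) p-prime _ = begin
  (+ 6) ^ e                          ≡⟨ ^-distribʳ-* (- + 2) (- + 3) e ⟩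
  (- + 2) ^ e * (- + 3) ^ e          ≈⟨ *-cong-mod (-2^e≡1 e p-prime p≡1+2e (326n²+3≡1or3mod8 (suc n)))
                                                   (-3^e≡-1 e p-prime p≡1+2e (326n²+3≡2mod3 n p-prime)) ⟩
  + 1 * - + 1                        ∎
  where
  e = 163n²+1 (suc n)
  p≡1+2e = 326n²+3≡1+2[163n²+1] (suc n)
  open import Relation.Binary.Reasoning.Setoid (≡-mod-setoid (326n²+3 (suc n)))
g^e≡-1 (suc n) (inj₂ (inj₂ (inj₂ refl))) p-prime _ = 326^e≡-1 n p-prime

k²g^e≡-1 : ∀ n {k g} → g ≡ - + 163 ⊎ g ≡ - + 3 ⊎ g ≡ + 6 ⊎ g ≡ + 326 →
           Prime (326n²+3 n) → ¬ (+ 326n²+3 n ∣ k * g) → (k * k * g) ^ 163n²+1 n ≡ - + 1 mod 326n²+3 n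
k²g^e≡-1 n {k} {g} g∈ p-prime p∤kg = begin
  (k * k * g) ^ e          ≡⟨ ^-distribʳ-* (k * k) g e ⟩
  (k * k) ^ e * g ^ e      ≈⟨ *-cong-mod (square^e≡1 e k p-prime p≡1+2e (p∤kg ∘ ∣m⇒∣m*n g))
                                         (g^e≡-1 n g∈ p-prime (p∤kg ∘ ∣n⇒∣m*n k)) ⟩
  + 1 * - + 1              ∎
  where
  e = 163n²+1 n
  p≡1+2e = 326n²+3≡1+2[163n²+1] n
  open import Relation.Binary.Reasoning.Setoid (≡-mod-setoid (326n²+3 n))

nonresidue⇒2∤index : ∀ {p e h m r} → 2 < p → h ^ e ≡ - + 1 mod p → h ^ m ≡ + 1 mod p →
                     r ℕ.* m ≡ 2 ℕ.* e → ¬ (2 ℕ.∣ r)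
nonresidue⇒2∤index {p} {e} {h} {m} 2<p h^e≡-1 h^m≡1 r*m≡2e (divides s refl) =
  ℕ.<⇒≱ 2<p (ℕ.∣⇒≤ (∣⇒∣ᵤ (_≡_mod_.n∣a-b (begin
    - + 1          ≈⟨ h^e≡-1 ⟨
    h ^ e          ≡⟨ cong (h ^_) m*s≡e ⟨
    h ^ (m ℕ.* s)  ≡⟨ ℤ.^-*-assoc h m s ⟨
    (h ^ m) ^ s    ≈⟨ ^-cong-mod s h^m≡1 ⟩
    (+ 1) ^ s      ≡⟨ ℤ.^-zeroˡ s ⟩
    + 1            ∎))))
  where
  open import Relation.Binary.Reasoning.Setoid (≡-mod-setoid p)
  regroup : ∀ s m → s ℕ.* 2 ℕ.* m ≡ 2 ℕ.* (m ℕ.* s)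
  regroup = ℕ.solve-∀
  m*s≡e : m ℕ.* s ≡ e
  m*s≡e = ℕ.*-cancelˡ-≡ (m ℕ.* s) e 2 (≡.trans (≡.sym (regroup s m)) r*m≡2e)

-- Small prime divisors of the residual index

NoRootMod : ℕ → ℕ → ℕ → Set
NoRootMod a b q = ∀ (s : Fin q) → ¬ (q ℕ.∣ a ℕ.+ b ℕ.* (toℕ s ℕ.* toℕ s))

∣a+bn²⇒∣a+b[n%q]² : ∀ a b n q .{{_ : ℕ.NonZero q}} →
                   q ℕ.∣ a ℕ.+ b ℕ.* (n ℕ.* n) → q ℕ.∣ a ℕ.+ b ℕ.* (n % q ℕ.* (n % q))
∣a+bn²⇒∣a+b[n%q]² a b n q q∣a+bn² = ℕ.∣m+n∣m⇒∣n q∣Xq+a+bs² (ℕ.∣m⇒∣m*n _ ℕ.∣-refl)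
  where
  s = n % q
  t = n / q
  expand : ∀ a b s t q → a ℕ.+ b ℕ.* ((s ℕ.+ t ℕ.* q) ℕ.* (s ℕ.+ t ℕ.* q))
                       ≡ q ℕ.* (b ℕ.* (2 ℕ.* s ℕ.* t ℕ.+ t ℕ.* t ℕ.* q)) ℕ.+ (a ℕ.+ b ℕ.* (s ℕ.* s))
  expand = ℕ.solve-∀
  q∣Xq+a+bs² : q ℕ.∣ q ℕ.* (b ℕ.* (2 ℕ.* s ℕ.* t ℕ.+ t ℕ.* t ℕ.* q)) ℕ.+ (a ℕ.+ b ℕ.* (s ℕ.* s))
  q∣Xq+a+bs² = ≡.subst (q ℕ.∣_) (≡.trans (cong (λ n → a ℕ.+ b ℕ.* (n ℕ.* n)) (m≡m%n+[m/n]*n n q))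
                                          (expand a b s t q))
                                q∣a+bn²

NoRootMod⇒∤ : ∀ a b q .{{_ : ℕ.NonZero q}} → NoRootMod a b q → ∀ n → ¬ (q ℕ.∣ a ℕ.+ b ℕ.* (n ℕ.* n))
NoRootMod⇒∤ a b q no-root n q∣a+bn² = no-root (fromℕ< n%q<q) (≡.subst (λ s → q ℕ.∣ a ℕ.+ b ℕ.* (s ℕ.* s))
                                                                      (≡.sym (toℕ-fromℕ< n%q<q))
                                                                      (∣a+bn²⇒∣a+b[n%q]² a b n q q∣a+bn²))
  where n%q<q = m%n<n n q

coprime-* : ∀ {r a b} → Coprime r a → Coprime r b → Coprime r (a ℕ.* b)
coprime-* {a = a} r⊥a r⊥b {d} (d∣r , d∣ab) = r⊥b (d∣r , coprime-divisor d⊥a d∣ab)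
  where
  d⊥a : Coprime d a
  d⊥a (c∣d , c∣a) = r⊥a (ℕ.∣-trans c∣d d∣r , c∣a)

prime∤⇒coprime : ∀ {q r} → Prime q → ¬ (q ℕ.∣ r) → Coprime r q
prime∤⇒coprime q-prime q∤r (d∣r , d∣q) with prime⇒irreducible q-prime d∣q
... | inj₁ d≡1 = d≡1
... | inj₂ refl = ⊥-elim (q∤r d∣r)

coprime-product : ∀ {r qs} → All (λ q → Prime q × ¬ (q ℕ.∣ r)) qs → Coprime r (product qs)
coprime-product []                       = ℕ.∣1⇒≡1 ∘ proj₂
coprime-product ((q-prime , q∤r) ∷ rest) = coprime-* (prime∤⇒coprime q-prime q∤r) (coprime-product rest)

oddPrimes≤37 : List ℕ
oddPrimes≤37 = 3 ∷ 5 ∷ 7 ∷ 11 ∷ 13 ∷ 17 ∷ 19 ∷ 23 ∷ 29 ∷ 31 ∷ 37 ∷ []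

oddPrimes≤37-noRoot-2+326x² : All (λ q → Prime q × NoRootMod 2 326 q) oddPrimes≤37
oddPrimes≤37-noRoot-2+326x² = from-yes (All.all? decide oddPrimes≤37)
  where
  decide : ∀ q → Dec (Prime q × NoRootMod 2 326 q)
  decide q = prime? q ×-dec Fin.all? (λ s → ¬? (q ℕ.∣? 2 ℕ.+ 326 ℕ.* (toℕ s ℕ.* toℕ s)))

coprime-primorial37 : ∀ {r n} → r ℕ.∣ 2 ℕ.+ 326 ℕ.* (n ℕ.* n) → ¬ (2 ℕ.∣ r) → Coprime r (primorial 37)
coprime-primorial37 {r} {n} r∣2+326n² 2∤r =
  coprime-product ((prime[2] , 2∤r) ∷ All.map odd∤r oddPrimes≤37-noRoot-2+326x²)
  where
  odd∤r : ∀ {q} → Prime q × NoRootMod 2 326 q → Prime q × ¬ (q ℕ.∣ r)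
  odd∤r {q} (q-prime , no-root) =
    q-prime , λ q∣r → NoRootMod⇒∤ 2 326 q {{prime⇒nonZero q-prime}} no-root n (ℕ.∣-trans q∣r r∣2+326n²)

≡326∣n∣²+3 : ∀ {p} n → + p ≡ + 326 * n * n + + 3 → p ≡ 326n²+3 ∣ n ∣
≡326∣n∣²+3 {p} n p≡326n²+3 = ℤ.+-injective (begin
  + p                              ≡⟨ p≡326n²+3 ⟩
  + 326 * n * n + + 3              ≡⟨ cong (_+ + 3) (ℤ.*-assoc (+ 326) n n) ⟩
  + 326 * (n * n) + + 3            ≡⟨ cong (λ x → + 326 * x + + 3) (square≡∣∣² n) ⟩
  + 326 * (+ ∣ n ∣ * + ∣ n ∣) + + 3  ≡⟨ regroup (+ ∣ n ∣) ⟩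
  + 3 + + 326 * (+ ∣ n ∣ * + ∣ n ∣)  ≡⟨ +326n²+3 ∣ n ∣ ⟨
  + 326n²+3 ∣ n ∣                  ∎)
  where
  open ≡.≡-Reasoning
  regroup : ∀ N → + 326 * (N * N) + + 3 ≡ + 3 + + 326 * (N * N)
  regroup = solve-∀

proposition1 : (k g : ℤ) (p : ℕ) (r : ℕ) →
    k ≢ + 0 →
    (g ≡ -[1+ 162 ] ⊎ g ≡ -[1+ 2 ] ⊎ g ≡ + 6 ⊎ g ≡ + 326) →
    Prime p →
    ¬ ((+ p) ℤDiv.∣ (k * g)) →
    ∃ (λ (n : ℤ) → + p ≡ + 326 * n * n + + 3) →
    IsResidualIndex p (k * k * g) r →
    Coprime r (primorial 37)
proposition1 k g p r _ g∈ p-prime p∤kg (n , p≡326n²+3) (m , (_ , hᵐ≡1 , _) , r*m≡p-1)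
  with refl ← ≡326∣n∣²+3 n p≡326n²+3 =
  coprime-primorial37 {n = ∣ n ∣} (divides m (≡.trans (≡.sym r*m≡p-1) (ℕ.*-comm r m)))
    (nonresidue⇒2∤index {e = 163n²+1 ∣ n ∣} {h = k * k * g} (s≤s (s≤s (s≤s z≤n)))
      (k²g^e≡-1 ∣ n ∣ {k = k} g∈ p-prime (p∤kg ∘ ∣⇒∣ᵤ))
      (congruent (∣ᵤ⇒∣ hᵐ≡1))
      (≡.trans r*m≡p-1 (ℕ.suc-injective (326n²+3≡1+2[163n²+1] ∣ n ∣))))
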